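{- The metric dimension of the incidence graph of a projective plane of order $q\geq 3$ is at most $4q-4$.
   Context: The incidence graph of a projective plane is the bipartite graph on points and lines with adjacency given by incidence. A set $S$ of vertices of a connected graph is resolving if the ordered distance lists of all vertices with respect to (a fixed ordering of) $S$ are pairwise distinct; the metric dimension is the minimum size of a resolving set. -}

module Defs where

open import Data.Nat using (ℕ; zero; suc; _<_)
open import Data.Fin using (Fin)
open import Data.Bool using (Bool; T)
open import Data.Sum using (_⊎_; inj₁; inj₂)
open import Data.Product using (Σ; ∃; _×_; _,_)
open import Data.Empty using (⊥)
open import Data.List using (List)
open import Data.List.Membership.Propositional using (_∈_)
open import Relation.Nullary using (¬_)
open import Relation.Binary.PropositionalEquality using (_≡_; _≢_)
open import Function.Bundles using (_↔_)

record IncStr : Set where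
  field
    np nl : ℕ
    I     : Fin np → Fin nl → Bool

module _ (S : IncStr) where
  open IncStr S

  Point = Fin np
  Line  = Fin nl

  _on_ : Point → Line → Set
  p on l = T (I p l)

  Collinear : Point → Point → Point → Set
  Collinear a b c = Σ Line λ l → a on l × b on l × c on l

  PointsOn : Line → Set
  PointsOn l = Σ Point λ p → p on l

  record IsProjectivePlaneOfOrder (q : ℕ) : Set where
    field
      two-points : ∀ (p p' : Point) → p ≢ p' →
        Σ Line λ l → p on l × p' on l × (∀ l' → p on l' → p' on l' → l' ≡ l)
      two-lines : ∀ (l l' : Line) → l ≢ l' →
        Σ Point λ p → p on l × p on l' × (∀ p' → p' on l → p' on l' → p' ≡ p)
      quadrangle : Σ Point λ a → Σ Point λ b → Σ Point λ c → Σ Point λ d →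
        (a ≢ b) × (a ≢ c) × (a ≢ d) × (b ≢ c) × (b ≢ d) × (c ≢ d) ×
        ¬ Collinear a b c × ¬ Collinear a b d ×
        ¬ Collinear a c d × ¬ Collinear b c d
      line-size : ∀ (l : Line) → Fin (suc q) ↔ PointsOn l

  Vertex : Set
  Vertex = Point ⊎ Line

  Adj : Vertex → Vertex → Set
  Adj (inj₁ p) (inj₂ l) = p on l
  Adj (inj₂ l) (inj₁ p) = p on l
  Adj (inj₁ _) (inj₁ _) = ⊥
  Adj (inj₂ _) (inj₂ _) = ⊥

  data Walk : Vertex → Vertex → ℕ → Set where
    here : ∀ {u} → Walk u u zero
    step : ∀ {u v w k} → Adj u v → Walk v w k → Walk u w (suc k)

  Dist : Vertex → Vertex → ℕ → Set
  Dist u v k = Walk u v k × (∀ m → m < k → ¬ Walk u v m)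

  Resolving : List Vertex → Set
  Resolving R = ∀ (u v : Vertex) →
    (∀ s → s ∈ R → Σ ℕ λ k → Dist u s k × Dist v s k) → u ≡ v

  MetricDimAtMost : ℕ → Set
  MetricDimAtMost m = Σ (List Vertex) λ R → Data.List.length R Data.Nat.≤ m × Resolving R

module Submission where

-- Fix a triangle ABC and take the q - 1 points of AB and of AC other than the vertices, and
-- the q - 1 lines through A and through B other than the sides: 4q - 4 vertices. The incidence
-- graph is bipartite, so distance parity tells points from lines, and distances 0 and 1 record
-- membership and incidence. A point outside this set lies on two of the chosen lines, hence is
-- their intersection, unless it lies on BC; there the chosen line through A pins it down, and C
-- is the only point of BC on no chosen line. For A and B themselves the pencils must contain two
-- lines, which is where q ≥ 3 enters. The configuration is self-dual, which settles the lines.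

open import Defs
open import Data.Nat using (ℕ; _≤_; _*_; _∸_; zero; suc; _+_; s≤s; z≤n)
open import Data.Nat.Properties using (≤-reflexive; *-distribˡ-∸)
open import Data.Nat.Tactic.RingSolver using (solve-∀)
import Data.Fin as Fin
open Fin using (Fin; punchIn; punchOut)
open import Data.Fin.Properties using (punchIn-injective; punchIn-punchOut; punchOut-injective)
open import Data.Bool using (Bool; true; false; not)
open import Data.Bool.Properties using (not-injective; T-irrelevant)
open import Data.Sum using (_⊎_; inj₁; inj₂)
open import Data.Sum.Properties using (inj₁-injective; inj₂-injective)
open import Data.Product using (Σ; ∃; _×_; _,_; proj₁; proj₂)
open import Data.Empty using (⊥-elim)
open import Data.List using (List; _++_; map; tabulate; length)
open import Data.List.Properties using (length-++; length-map; length-tabulate)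
open import Data.List.Membership.Propositional using (_∈_)
open import Data.List.Membership.Propositional.Properties using (∈-map⁺; ∈-++⁺ˡ; ∈-++⁺ʳ; ∈-tabulate⁺)
open import Data.List.Relation.Binary.Subset.Propositional using (_⊆_)
open import Relation.Nullary using (¬_; Dec; yes; no)
open import Relation.Nullary.Decidable using (T?)
open import Relation.Binary.PropositionalEquality
open import Function.Base using (_∘_)
open import Function.Bundles using (_↔_; Inverse)

module _ {n : ℕ} {i j : Fin (suc (suc n))} (i≢j : i ≢ j) where

  punchIn₂ : Fin n → Fin (suc (suc n))
  punchIn₂ k = punchIn i (punchIn (punchOut i≢j) k)

  punchIn₂-injective : ∀ {k k'} → punchIn₂ k ≡ punchIn₂ k' → k ≡ k'
  punchIn₂-injective e = punchIn-injective _ _ _ (punchIn-injective i _ _ e)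

  punchIn₂-surjective : ∀ {k} → k ≢ i → k ≢ j → ∃ λ t → punchIn₂ t ≡ k
  punchIn₂-surjective {k} k≢i k≢j = punchOut j'≢k' , (begin
      punchIn i (punchIn j' (punchOut j'≢k'))  ≡⟨ cong (punchIn i) (punchIn-punchOut j'≢k') ⟩
      punchIn i (punchOut i≢k)                 ≡⟨ punchIn-punchOut i≢k ⟩
      k                                        ∎)
    where
    open ≡-Reasoning
    i≢k = ≢-sym k≢i
    j' = punchOut i≢j
    j'≢k' : j' ≢ punchOut i≢k
    j'≢k' e = k≢j (sym (punchOut-injective i≢j i≢k e))

module _ {A : Set} {n : ℕ} (e : Fin (suc (suc n)) ↔ A) {a b : A} (a≢b : a ≢ b) where
  open Inverse e

  private
    from-≢ : ∀ {x y} → x ≢ y → from x ≢ from y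
    from-≢ {x} {y} x≢y eq = x≢y (trans (sym (strictlyInverseˡ x)) (trans (cong to eq) (strictlyInverseˡ y)))

  allBut₂ : Fin n → A
  allBut₂ k = to (punchIn₂ (from-≢ a≢b) k)

  allBut₂-injective : ∀ {k k'} → allBut₂ k ≡ allBut₂ k' → k ≡ k'
  allBut₂-injective {k} {k'} eq = punchIn₂-injective (from-≢ a≢b) (begin
      punchIn₂ (from-≢ a≢b) k   ≡⟨ sym (strictlyInverseʳ _) ⟩
      from (allBut₂ k)          ≡⟨ cong from eq ⟩
      from (allBut₂ k')         ≡⟨ strictlyInverseʳ _ ⟩
      punchIn₂ (from-≢ a≢b) k'  ∎)
    where open ≡-Reasoning

  allBut₂-surjective : ∀ {c} → c ≢ a → c ≢ b → ∃ λ k → allBut₂ k ≡ c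
  allBut₂-surjective {c} c≢a c≢b
    with punchIn₂-surjective (from-≢ a≢b) (from-≢ c≢a) (from-≢ c≢b)
  ... | k , eq = k , trans (cong to eq) (strictlyInverseˡ c)

dual : IncStr → IncStr
dual S = record { np = IncStr.nl S ; nl = IncStr.np S ; I = λ l p → IncStr.I S p l }

-- Unlike IsProjectivePlaneOfOrder this is closed under duality, so the separation argument
-- for points also yields the one for lines.
record IsWeakProjectivePlane (S : IncStr) : Set where
  field
    two-points : ∀ (p p' : Point S) → p ≢ p' →
      Σ (Line S) λ l → _on_ S p l × _on_ S p' l × (∀ l' → _on_ S p l' → _on_ S p' l' → l' ≡ l)
    two-lines : ∀ (l l' : Line S) → l ≢ l' →
      Σ (Point S) λ p → _on_ S p l × _on_ S p l' × (∀ p' → _on_ S p' l → _on_ S p' l' → p' ≡ p)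

isWeakProjectivePlane : ∀ {S q} → IsProjectivePlaneOfOrder S q → IsWeakProjectivePlane S
isWeakProjectivePlane PP = record { two-points = two-points ; two-lines = two-lines }
  where open IsProjectivePlaneOfOrder PP

isWeakProjectivePlane-dual : ∀ {S} → IsWeakProjectivePlane S → IsWeakProjectivePlane (dual S)
isWeakProjectivePlane-dual W = record { two-points = two-lines ; two-lines = two-points }
  where open IsWeakProjectivePlane W

module Geometry (S : IncStr) where

  infix 4 _I_
  _I_ : Point S → Line S → Set
  p I l = _on_ S p l

  _I?_ : ∀ p l → Dec (p I l)
  p I? l = T? (IncStr.I S p l)

  I∧¬I⇒≢ : ∀ {p p' l} → p I l → ¬ p' I l → p ≢ p'
  I∧¬I⇒≢ p-l ¬p'-l refl = ¬p'-l p-l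

  ¬I∧I⇒≢ : ∀ {p p' l} → ¬ p I l → p' I l → p ≢ p'
  ¬I∧I⇒≢ ¬p-l p'-l refl = ¬p-l p'-l

  I∧¬I⇒≢ˡ : ∀ {p l l'} → p I l → ¬ p I l' → l ≢ l'
  I∧¬I⇒≢ˡ p-l ¬p-l' refl = ¬p-l' p-l

  -- p' is at distance 0, resp. 1, from every vertex of P, resp. L, that p is.
  PointMimics : List (Point S) → List (Line S) → Point S → Point S → Set
  PointMimics P L p p' = (p ∈ P → p' ≡ p) × (∀ {l} → l ∈ L → p I l → p' I l)

  LineMimics : List (Point S) → List (Line S) → Line S → Line S → Set
  LineMimics P L l l' = (l ∈ L → l' ≡ l) × (∀ {p} → p ∈ P → p I l → p I l')

  SeparatesPoints : List (Point S) → List (Line S) → Set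
  SeparatesPoints P L = ∀ p p' → PointMimics P L p p' → PointMimics P L p' p → p ≡ p'

  SeparatesLines : List (Point S) → List (Line S) → Set
  SeparatesLines P L = ∀ l l' → LineMimics P L l l' → LineMimics P L l' l → l ≡ l'

  TwoPointsOn : List (Point S) → Line S → Set
  TwoPointsOn P l = Σ (Point S) λ s → Σ (Point S) λ s' → s ∈ P × s' ∈ P × s ≢ s' × s I l × s' I l

  TwoLinesThrough : List (Line S) → Point S → Set
  TwoLinesThrough L p = Σ (Line S) λ m → Σ (Line S) λ m' → m ∈ L × m' ∈ L × m ≢ m' × p I m × p I m'

  TwoPointsOn-mono : ∀ {P P' l} → P ⊆ P' → TwoPointsOn P l → TwoPointsOn P' l
  TwoPointsOn-mono P⊆P' (s , s' , s∈P , s'∈P , rest) = s , s' , P⊆P' s∈P , P⊆P' s'∈P , rest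

  TwoLinesThrough-mono : ∀ {L L' p} → L ⊆ L' → TwoLinesThrough L p → TwoLinesThrough L' p
  TwoLinesThrough-mono L⊆L' (m , m' , m∈L , m'∈L , rest) = m , m' , L⊆L' m∈L , L⊆L' m'∈L , rest

  record Triangle : Set where
    field
      A B C     : Point S
      ab ac bc  : Line S
      A-ab      : A I ab
      B-ab      : B I ab
      A-ac      : A I ac
      C-ac      : C I ac
      B-bc      : B I bc
      C-bc      : C I bc
      ¬C-ab     : ¬ C I ab
      ¬B-ac     : ¬ B I ac
      ¬A-bc     : ¬ A I bc

  module _ (T : Triangle) where
    open Triangle T

    record Spans (P : List (Point S)) (L : List (Line S)) : Set where
      field
        side-ab       : ∀ {s} → s I ab → ¬ s I ac → ¬ s I bc → s ∈ P
        side-ac       : ∀ {s} → s I ac → ¬ s I ab → ¬ s I bc → s ∈ P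
        pencil-A      : ∀ {m} → A I m → ¬ B I m → ¬ C I m → m ∈ L
        pencil-B      : ∀ {m} → B I m → ¬ A I m → ¬ C I m → m ∈ L
        two-on-ab     : TwoPointsOn P ab
        two-on-ac     : TwoPointsOn P ac
        two-through-A : TwoLinesThrough L A
        two-through-B : TwoLinesThrough L B

module _ {S : IncStr} where
  private
    module G  = Geometry S
    module G* = Geometry (dual S)

  triangle-dual : G.Triangle → G*.Triangle
  triangle-dual T = record
    { A = ab ; B = ac ; C = bc ; ab = A ; ac = B ; bc = C
    ; A-ab = A-ab ; B-ab = A-ac ; A-ac = B-ab ; C-ac = B-bc ; B-bc = C-ac ; C-bc = C-bc
    ; ¬C-ab = ¬A-bc ; ¬B-ac = ¬B-ac ; ¬A-bc = ¬C-ab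
    }
    where open G.Triangle T

  spans-dual : ∀ {T P L} → G.Spans T P L → G*.Spans (triangle-dual T) L P
  spans-dual σ = record
    { side-ab = pencil-A ; side-ac = pencil-B ; pencil-A = side-ab ; pencil-B = side-ac
    ; two-on-ab = two-through-A ; two-on-ac = two-through-B
    ; two-through-A = two-on-ab ; two-through-B = two-on-ac
    }
    where open G.Spans σ

module WeakProjectivePlane {S : IncStr} (W : IsWeakProjectivePlane S) where
  open IsWeakProjectivePlane W
  open Geometry S

  join : (p p' : Point S) → p ≢ p' → Line S
  join p p' p≢p' = proj₁ (two-points p p' p≢p')

  join-I₁ : ∀ {p p'} (p≢p' : p ≢ p') → p I join p p' p≢p'
  join-I₁ {p} {p'} p≢p' = proj₁ (proj₂ (two-points p p' p≢p'))

  join-I₂ : ∀ {p p'} (p≢p' : p ≢ p') → p' I join p p' p≢p'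
  join-I₂ {p} {p'} p≢p' = proj₁ (proj₂ (proj₂ (two-points p p' p≢p')))

  meet : (l l' : Line S) → l ≢ l' → Point S
  meet l l' l≢l' = proj₁ (two-lines l l' l≢l')

  meet-I₁ : ∀ {l l'} (l≢l' : l ≢ l') → meet l l' l≢l' I l
  meet-I₁ {l} {l'} l≢l' = proj₁ (proj₂ (two-lines l l' l≢l'))

  meet-I₂ : ∀ {l l'} (l≢l' : l ≢ l') → meet l l' l≢l' I l'
  meet-I₂ {l} {l'} l≢l' = proj₁ (proj₂ (proj₂ (two-lines l l' l≢l')))

  line-unique : ∀ {p p' l l'} → p ≢ p' → p I l → p' I l → p I l' → p' I l' → l ≡ l'
  line-unique {p} {p'} p≢p' p-l p'-l p-l' p'-l' =
    trans (unique _ p-l p'-l) (sym (unique _ p-l' p'-l'))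
    where unique = proj₂ (proj₂ (proj₂ (two-points p p' p≢p')))

  point-unique : ∀ {p p' l l'} → l ≢ l' → p I l → p I l' → p' I l → p' I l' → p ≡ p'
  point-unique {l = l} {l'} l≢l' p-l p-l' p'-l p'-l' =
    trans (unique _ p-l p-l') (sym (unique _ p'-l p'-l'))
    where unique = proj₂ (proj₂ (proj₂ (two-lines l l' l≢l')))

  noncollinear⇒Triangle : ∀ {A B C} → A ≢ B → A ≢ C → B ≢ C → ¬ Collinear S A B C → Triangle
  noncollinear⇒Triangle {A} {B} {C} A≢B A≢C B≢C ¬ABC = record
    { A = A ; B = B ; C = C ; ab = join A B A≢B ; ac = join A C A≢C ; bc = join B C B≢C
    ; A-ab = join-I₁ A≢B ; B-ab = join-I₂ A≢B ; A-ac = join-I₁ A≢C ; C-ac = join-I₂ A≢C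
    ; B-bc = join-I₁ B≢C ; C-bc = join-I₂ B≢C
    ; ¬C-ab = λ C-ab → ¬ABC (_ , join-I₁ A≢B , join-I₂ A≢B , C-ab)
    ; ¬B-ac = λ B-ac → ¬ABC (_ , join-I₁ A≢C , B-ac , join-I₂ A≢C)
    ; ¬A-bc = λ A-bc → ¬ABC (_ , A-bc , join-I₁ B≢C , join-I₂ B≢C)
    }

  module _ {T : Triangle} {P L} (σ : Spans T P L) where
    open Triangle T
    open Spans σ

    private
      A≢B : A ≢ B
      A≢B = I∧¬I⇒≢ A-ac ¬B-ac
      A≢C : A ≢ C
      A≢C = I∧¬I⇒≢ A-ab ¬C-ab
      B≢C : B ≢ C
      B≢C = I∧¬I⇒≢ B-ab ¬C-ab
      ab≢ac : ab ≢ ac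
      ab≢ac = ≢-sym (I∧¬I⇒≢ˡ C-ac ¬C-ab)
      ab≢bc : ab ≢ bc
      ab≢bc = I∧¬I⇒≢ˡ A-ab ¬A-bc
      ac≢bc : ac ≢ bc
      ac≢bc = I∧¬I⇒≢ˡ A-ac ¬A-bc

    on-ab : ∀ {m p} → A I m → B I m → p I m → p I ab
    on-ab {p = p} A-m B-m p-m = subst (p I_) (line-unique A≢B A-m B-m A-ab B-ab) p-m

    on-ac : ∀ {m p} → A I m → C I m → p I m → p I ac
    on-ac {p = p} A-m C-m p-m = subst (p I_) (line-unique A≢C A-m C-m A-ac C-ac) p-m

    on-bc : ∀ {m p} → B I m → C I m → p I m → p I bc
    on-bc {p = p} B-m C-m p-m = subst (p I_) (line-unique B≢C B-m C-m B-bc C-bc) p-m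

    line-through-A∈L : ∀ {m p} → A I m → p I m → ¬ p I ab → ¬ p I ac → m ∈ L
    line-through-A∈L A-m p-m ¬p-ab ¬p-ac =
      pencil-A A-m (λ B-m → ¬p-ab (on-ab A-m B-m p-m)) (λ C-m → ¬p-ac (on-ac A-m C-m p-m))

    line-through-B∈L : ∀ {m p} → B I m → p I m → ¬ p I ab → ¬ p I bc → m ∈ L
    line-through-B∈L B-m p-m ¬p-ab ¬p-bc =
      pencil-B B-m (λ A-m → ¬p-ab (on-ab A-m B-m p-m)) (λ C-m → ¬p-bc (on-bc B-m C-m p-m))

    off-sides⇒TwoLinesThrough : ∀ {p} → ¬ p I ab → ¬ p I ac → ¬ p I bc → TwoLinesThrough L p
    off-sides⇒TwoLinesThrough {p} ¬p-ab ¬p-ac ¬p-bc =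
      join A p A≢p , join B p B≢p ,
      line-through-A∈L (join-I₁ A≢p) (join-I₂ A≢p) ¬p-ab ¬p-ac ,
      line-through-B∈L (join-I₁ B≢p) (join-I₂ B≢p) ¬p-ab ¬p-bc ,
      Ap≢Bp , join-I₂ A≢p , join-I₂ B≢p
      where
      A≢p = I∧¬I⇒≢ A-ab ¬p-ab
      B≢p = I∧¬I⇒≢ B-ab ¬p-ab
      Ap≢Bp : join A p A≢p ≢ join B p B≢p
      Ap≢Bp eq = ¬p-ab (on-ab (join-I₁ A≢p) (subst (B I_) (sym eq) (join-I₁ B≢p)) (join-I₂ A≢p))

    classify : ∀ p → p ∈ P ⊎ TwoLinesThrough L p ⊎ (p I bc × ¬ p I ab)
    classify p with p I? ab | p I? ac | p I? bc
    ... | yes p-ab | yes p-ac | _       =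
      inj₂ (inj₁ (subst (TwoLinesThrough L) (point-unique ab≢ac A-ab A-ac p-ab p-ac) two-through-A))
    ... | yes p-ab | no _     | yes p-bc =
      inj₂ (inj₁ (subst (TwoLinesThrough L) (point-unique ab≢bc B-ab B-bc p-ab p-bc) two-through-B))
    ... | yes p-ab | no ¬p-ac | no ¬p-bc = inj₁ (side-ab p-ab ¬p-ac ¬p-bc)
    ... | no ¬p-ab | _        | yes p-bc = inj₂ (inj₂ (p-bc , ¬p-ab))
    ... | no ¬p-ab | yes p-ac | no ¬p-bc = inj₁ (side-ac p-ac ¬p-ab ¬p-bc)
    ... | no ¬p-ab | no ¬p-ac | no ¬p-bc = inj₂ (inj₁ (off-sides⇒TwoLinesThrough ¬p-ab ¬p-ac ¬p-bc))

    TwoLinesThrough⇒determined : ∀ {p p'} → TwoLinesThrough L p →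
      (∀ {l} → l ∈ L → p I l → p' I l) → p' ≡ p
    TwoLinesThrough⇒determined (m , m' , m∈L , m'∈L , m≢m' , p-m , p-m') follows =
      point-unique m≢m' (follows m∈L p-m) (follows m'∈L p-m') p-m p-m'

    -- the line joining A to x lies in L and meets bc only in x
    off-ac-on-bc-determined : ∀ {x x'} → x I bc → ¬ x I ab → ¬ x I ac →
      (∀ {l} → l ∈ L → x I l → x' I l) → x' I bc → x' ≡ x
    off-ac-on-bc-determined {x} x-bc ¬x-ab ¬x-ac follows x'-bc =
      point-unique (I∧¬I⇒≢ˡ (join-I₁ A≢x) ¬A-bc)
        (follows (line-through-A∈L (join-I₁ A≢x) (join-I₂ A≢x) ¬x-ab ¬x-ac) (join-I₂ A≢x)) x'-bc
        (join-I₂ A≢x) x-bc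
      where A≢x = I∧¬I⇒≢ A-ab ¬x-ab

    on-bc-separated : ∀ {x x'} → x I bc → ¬ x I ab → x' I bc → ¬ x' I ab →
      (∀ {l} → l ∈ L → x I l → x' I l) → (∀ {l} → l ∈ L → x' I l → x I l) → x ≡ x'
    on-bc-separated {x} {x'} x-bc ¬x-ab x'-bc ¬x'-ab follows follows' with x I? ac | x' I? ac
    ... | no ¬x-ac | _         = sym (off-ac-on-bc-determined x-bc ¬x-ab ¬x-ac follows x'-bc)
    ... | _        | no ¬x'-ac = off-ac-on-bc-determined x'-bc ¬x'-ab ¬x'-ac follows' x-bc
    ... | yes x-ac | yes x'-ac = point-unique ac≢bc x-ac x-bc x'-ac x'-bc

    spans⇒separatesPoints : SeparatesPoints P L
    spans⇒separatesPoints p p' (in-P , follows) (in-P' , follows') with classify p | classify p'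
    ... | inj₁ p∈P                   | _                = sym (in-P p∈P)
    ... | _                          | inj₁ p'∈P        = in-P' p'∈P
    ... | inj₂ (inj₁ two)            | _                = sym (TwoLinesThrough⇒determined two follows)
    ... | _                          | inj₂ (inj₁ two') = TwoLinesThrough⇒determined two' follows'
    ... | inj₂ (inj₂ (p-bc , ¬p-ab)) | inj₂ (inj₂ (p'-bc , ¬p'-ab)) =
      on-bc-separated p-bc ¬p-ab p'-bc ¬p'-ab follows follows'

-- SeparatesLines S P L and SeparatesPoints (dual S) L P are definitionally equal.
spans⇒separatesLines : ∀ {S} → IsWeakProjectivePlane S → ∀ {T P L} →
  Geometry.Spans S T P L → Geometry.SeparatesLines S P L
spans⇒separatesLines W σ =
  WeakProjectivePlane.spans⇒separatesPoints (isWeakProjectivePlane-dual W) (spans-dual σ)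

module IncidenceGraph (S : IncStr) where
  open Geometry S

  side : Vertex S → Bool
  side (inj₁ _) = true
  side (inj₂ _) = false

  adj-side : ∀ {u v} → Adj S u v → side v ≡ not (side u)
  adj-side {inj₁ _} {inj₂ _} _ = refl
  adj-side {inj₂ _} {inj₁ _} _ = refl

  adj-irreflexive : ∀ {u} → ¬ Adj S u u
  adj-irreflexive {inj₁ _} ()
  adj-irreflexive {inj₂ _} ()

  walks-same-side : ∀ {u v w k} → Walk S u w k → Walk S v w k → side u ≡ side v
  walks-same-side here here = refl
  walks-same-side {u} {v} (step {v = u'} u~u' p) (step {v = v'} v~v' p') =
    not-injective (trans (sym (adj-side {u} {u'} u~u')) (trans (walks-same-side p p') (adj-side {v} {v'} v~v')))

  dist-self : ∀ {u k} → Dist S u u k → k ≡ 0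
  dist-self {k = zero}  _            = refl
  dist-self {k = suc _} (_ , minimal) = ⊥-elim (minimal 0 (s≤s z≤n) here)

  dist-adj : ∀ {u s k} → Adj S u s → Dist S u s k → k ≡ 1
  dist-adj {u} {k = zero} u~s (here , _) = ⊥-elim (adj-irreflexive {u} u~s)
  dist-adj {k = suc zero}    _   _             = refl
  dist-adj {k = suc (suc _)} u~s (_ , minimal) = ⊥-elim (minimal 1 (s≤s (s≤s z≤n)) (step u~s here))

  walk-zero : ∀ {u s} → Walk S u s 0 → u ≡ s
  walk-zero here = refl

  walk-one : ∀ {u s} → Walk S u s 1 → Adj S u s
  walk-one (step u~s here) = u~s

  equidistant-self : ∀ {u v s k} → Dist S u s k → Dist S v s k → u ≡ s → v ≡ s
  equidistant-self d (v⇝s , _) refl with dist-self d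
  ... | refl = walk-zero v⇝s

  equidistant-adj : ∀ {u v s k} → Dist S u s k → Dist S v s k → Adj S u s → Adj S v s
  equidistant-adj d (v⇝s , _) u~s with dist-adj u~s d
  ... | refl = walk-one v⇝s

  Equidistant : List (Vertex S) → Vertex S → Vertex S → Set
  Equidistant R u v = ∀ s → s ∈ R → ∃ λ k → Dist S u s k × Dist S v s k

  Equidistant-sym : ∀ {R u v} → Equidistant R u v → Equidistant R v u
  Equidistant-sym eq s s∈R with eq s s∈R
  ... | k , d , d' = k , d' , d

  Equidistant-side : ∀ {R u v s} → s ∈ R → Equidistant R u v → side u ≡ side v
  Equidistant-side s∈R eq with eq _ s∈R
  ... | _ , (u⇝s , _) , (v⇝s , _) = walks-same-side u⇝s v⇝s

  vertices : List (Point S) → List (Line S) → List (Vertex S)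
  vertices P L = map inj₁ P ++ map inj₂ L

  length-vertices : ∀ P L → length (vertices P L) ≡ length P + length L
  length-vertices P L = trans (length-++ (map inj₁ P)) (cong₂ _+_ (length-map inj₁ P) (length-map inj₂ L))

  module _ {P : List (Point S)} {L : List (Line S)} where
    private
      point∈vertices : ∀ {s} → s ∈ P → inj₁ s ∈ vertices P L
      point∈vertices s∈P = ∈-++⁺ˡ (∈-map⁺ inj₁ s∈P)

      line∈vertices : ∀ {l} → l ∈ L → inj₂ l ∈ vertices P L
      line∈vertices l∈L = ∈-++⁺ʳ (map inj₁ P) (∈-map⁺ inj₂ l∈L)

    Equidistant⇒PointMimics : ∀ {p p'} → Equidistant (vertices P L) (inj₁ p) (inj₁ p') → PointMimics P L p p'
    Equidistant⇒PointMimics {p} {p'} eq = at-points , at-lines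
      where
      at-points : p ∈ P → p' ≡ p
      at-points p∈P with eq _ (point∈vertices p∈P)
      ... | _ , d , d' = inj₁-injective (equidistant-self d d' refl)
      at-lines : ∀ {l} → l ∈ L → p I l → p' I l
      at-lines l∈L p-l with eq _ (line∈vertices l∈L)
      ... | _ , d , d' = equidistant-adj d d' p-l

    Equidistant⇒LineMimics : ∀ {l l'} → Equidistant (vertices P L) (inj₂ l) (inj₂ l') → LineMimics P L l l'
    Equidistant⇒LineMimics {l} {l'} eq = at-lines , at-points
      where
      at-lines : l ∈ L → l' ≡ l
      at-lines l∈L with eq _ (line∈vertices l∈L)
      ... | _ , d , d' = inj₂-injective (equidistant-self d d' refl)
      at-points : ∀ {p} → p ∈ P → p I l → p I l'
      at-points p∈P p-l with eq _ (point∈vertices p∈P)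
      ... | _ , d , d' = equidistant-adj {inj₂ l} {inj₂ l'} d d' p-l

    -- P must be non-empty for the parity of distances to tell points from lines.
    separating⇒resolving : ∀ {s₀} → s₀ ∈ P → SeparatesPoints P L → SeparatesLines P L →
      Resolving S (vertices P L)
    separating⇒resolving _ separates _ (inj₁ p) (inj₁ p') eq =
      cong inj₁ (separates p p' (Equidistant⇒PointMimics eq) (Equidistant⇒PointMimics (Equidistant-sym eq)))
    separating⇒resolving _ _ separates (inj₂ l) (inj₂ l') eq =
      cong inj₂ (separates l l' (Equidistant⇒LineMimics eq) (Equidistant⇒LineMimics (Equidistant-sym eq)))
    separating⇒resolving s₀∈P _ _ (inj₁ _) (inj₂ _) eq with Equidistant-side (point∈vertices s₀∈P) eq
    ... | ()
    separating⇒resolving s₀∈P _ _ (inj₂ _) (inj₁ _) eq with Equidistant-side (point∈vertices s₀∈P) eq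
    ... | ()

module LineExceptTwoPoints {S : IncStr} (W : IsWeakProjectivePlane S) {n : ℕ} {l : Line S}
  (enum : Fin (suc (suc n)) ↔ PointsOn S l) {x y : Point S}
  (x-l : _on_ S x l) (y-l : _on_ S y l) (x≢y : x ≢ y) where
  open Geometry S
  open WeakProjectivePlane W

  private
    PointsOn-≡ : {a b : PointsOn S l} → proj₁ a ≡ proj₁ b → a ≡ b
    PointsOn-≡ {z , z-l} {.z , z-l'} refl = cong (z ,_) (T-irrelevant z-l z-l')

    PointsOn-≢ : ∀ {z w} {z-l : z I l} {w-l : w I l} → z ≢ w → (z , z-l) ≢ (w , w-l)
    PointsOn-≢ z≢w = z≢w ∘ cong proj₁

    x≢y-on-l : (x , x-l) ≢ (y , y-l)
    x≢y-on-l = PointsOn-≢ x≢y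

  point : Fin n → Point S
  point k = proj₁ (allBut₂ enum x≢y-on-l k)

  point-I : ∀ k → point k I l
  point-I k = proj₂ (allBut₂ enum x≢y-on-l k)

  point-injective : ∀ {k k'} → point k ≡ point k' → k ≡ k'
  point-injective eq = allBut₂-injective enum x≢y-on-l (PointsOn-≡ eq)

  point-surjective : ∀ {z} → z I l → z ≢ x → z ≢ y → ∃ λ k → point k ≡ z
  point-surjective z-l z≢x z≢y
    with allBut₂-surjective enum x≢y-on-l {c = _ , z-l} (PointsOn-≢ z≢x) (PointsOn-≢ z≢y)
  ... | k , eq = k , cong proj₁ eq

  points : List (Point S)
  points = tabulate point

  length-points : length points ≡ n
  length-points = length-tabulate point

  ∈-points : ∀ {z} → z I l → z ≢ x → z ≢ y → z ∈ points
  ∈-points z-l z≢x z≢y with point-surjective z-l z≢x z≢y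
  ... | k , refl = ∈-tabulate⁺ k

  TwoPointsOn-points : ∀ {i j} → i ≢ j → TwoPointsOn points l
  TwoPointsOn-points {i} {j} i≢j =
    point i , point j , ∈-tabulate⁺ i , ∈-tabulate⁺ j , i≢j ∘ point-injective , point-I i , point-I j

  module _ {X : Point S} (¬X-l : ¬ X I l) where
    private
      X≢point : ∀ k → X ≢ point k
      X≢point k = ¬I∧I⇒≢ ¬X-l (point-I k)

    line : Fin n → Line S
    line k = join X (point k) (X≢point k)

    pencil : List (Line S)
    pencil = tabulate line

    length-pencil : length pencil ≡ n
    length-pencil = length-tabulate line

    ∈-pencil : ∀ {m} → X I m → ¬ x I m → ¬ y I m → m ∈ pencil
    ∈-pencil {m} X-m ¬x-m ¬y-m with point-surjective (meet-I₂ m≢l) z≢x z≢y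
      where
      m≢l = I∧¬I⇒≢ˡ X-m ¬X-l
      z≢x : meet m l m≢l ≢ x
      z≢x eq = ¬x-m (subst (_I m) eq (meet-I₁ m≢l))
      z≢y : meet m l m≢l ≢ y
      z≢y eq = ¬y-m (subst (_I m) eq (meet-I₁ m≢l))
    ... | k , eq = subst (_∈ pencil) line≡m (∈-tabulate⁺ k)
      where
      line≡m : line k ≡ m
      line≡m = line-unique (X≢point k) (join-I₁ _) (join-I₂ _) X-m (subst (_I m) (sym eq) (meet-I₁ _))

    TwoLinesThrough-pencil : ∀ {i j} → i ≢ j → TwoLinesThrough pencil X
    TwoLinesThrough-pencil {i} {j} i≢j =
      line i , line j , ∈-tabulate⁺ i , ∈-tabulate⁺ j , line-i≢line-j , join-I₁ _ , join-I₁ _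
      where
      line-i≢line-j : line i ≢ line j
      line-i≢line-j eq = i≢j (point-injective (point-unique (I∧¬I⇒≢ˡ (join-I₁ _) ¬X-l)
        (join-I₂ _) (point-I i) (subst (point j I_) (sym eq) (join-I₂ _)) (point-I j)))

[n+n]+[n+n]≡4*n : ∀ n → (n + n) + (n + n) ≡ 4 * n
[n+n]+[n+n]≡4*n = solve-∀

module Construction (S : IncStr) (r : ℕ) (PP : IsProjectivePlaneOfOrder S (suc (suc (suc r)))) where
  open IsProjectivePlaneOfOrder PP using (quadrangle; line-size)
  open Geometry S
  open IncidenceGraph S

  W : IsWeakProjectivePlane S
  W = isWeakProjectivePlane PP

  open WeakProjectivePlane W

  ABC : Triangle
  ABC with quadrangle
  ... | _ , _ , _ , _ , A≢B , A≢C , _ , B≢C , _ , _ , ¬ABC , _ = noncollinear⇒Triangle A≢B A≢C B≢C ¬ABC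

  open Triangle ABC

  module AB = LineExceptTwoPoints W (line-size ab) A-ab B-ab (I∧¬I⇒≢ A-ac ¬B-ac)
  module AC = LineExceptTwoPoints W (line-size ac) A-ac C-ac (I∧¬I⇒≢ A-ab ¬C-ab)
  module BC = LineExceptTwoPoints W (line-size bc) B-bc C-bc (I∧¬I⇒≢ B-ab ¬C-ab)

  P : List (Point S)
  P = AB.points ++ AC.points

  L : List (Line S)
  L = BC.pencil ¬A-bc ++ AC.pencil ¬B-ac

  0≢1 : Fin.zero {suc r} ≢ Fin.suc Fin.zero
  0≢1 ()

  spans : Spans ABC P L
  spans = record
    { side-ab = λ s-ab ¬s-ac ¬s-bc → ∈-++⁺ˡ (AB.∈-points s-ab (¬I∧I⇒≢ ¬s-ac A-ac) (¬I∧I⇒≢ ¬s-bc B-bc))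
    ; side-ac = λ s-ac ¬s-ab ¬s-bc → ∈-++⁺ʳ AB.points (AC.∈-points s-ac (¬I∧I⇒≢ ¬s-ab A-ab) (¬I∧I⇒≢ ¬s-bc C-bc))
    ; pencil-A = λ A-m ¬B-m ¬C-m → ∈-++⁺ˡ (BC.∈-pencil ¬A-bc A-m ¬B-m ¬C-m)
    ; pencil-B = λ B-m ¬A-m ¬C-m → ∈-++⁺ʳ (BC.pencil ¬A-bc) (AC.∈-pencil ¬B-ac B-m ¬A-m ¬C-m)
    ; two-on-ab = TwoPointsOn-mono ∈-++⁺ˡ (AB.TwoPointsOn-points 0≢1)
    ; two-on-ac = TwoPointsOn-mono (∈-++⁺ʳ AB.points) (AC.TwoPointsOn-points 0≢1)
    ; two-through-A = TwoLinesThrough-mono ∈-++⁺ˡ (BC.TwoLinesThrough-pencil ¬A-bc 0≢1)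
    ; two-through-B = TwoLinesThrough-mono (∈-++⁺ʳ (BC.pencil ¬A-bc)) (AC.TwoLinesThrough-pencil ¬B-ac 0≢1)
    }

  resolving : Resolving S (vertices P L)
  resolving = separating⇒resolving (∈-++⁺ˡ (∈-tabulate⁺ {f = AB.point} Fin.zero))
    (spans⇒separatesPoints spans) (spans⇒separatesLines W spans)

  length-P : length P ≡ suc (suc r) + suc (suc r)
  length-P = trans (length-++ AB.points) (cong₂ _+_ AB.length-points AC.length-points)

  length-L : length L ≡ suc (suc r) + suc (suc r)
  length-L = trans (length-++ (BC.pencil ¬A-bc)) (cong₂ _+_ (BC.length-pencil ¬A-bc) (AC.length-pencil ¬B-ac))

  length-resolving : length (vertices P L) ≡ 4 * suc (suc r)
  length-resolving = begin
    length (vertices P L)                                      ≡⟨ length-vertices P L ⟩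
    length P + length L                                        ≡⟨ cong₂ _+_ length-P length-L ⟩
    (suc (suc r) + suc (suc r)) + (suc (suc r) + suc (suc r))  ≡⟨ [n+n]+[n+n]≡4*n (suc (suc r)) ⟩
    4 * suc (suc r)                                            ∎
    where open ≡-Reasoning

proposition2p3 : (S : IncStr) (q : ℕ) → 3 ≤ q →
    IsProjectivePlaneOfOrder S q → MetricDimAtMost S (4 * q ∸ 4)
proposition2p3 S q@(suc (suc (suc r))) (s≤s (s≤s (s≤s z≤n))) PP =
  vertices P L , ≤-reflexive (trans length-resolving (*-distribˡ-∸ 4 q 1)) , resolving
  where
  open Construction S r PP
  open IncidenceGraph S using (vertices)
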